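{- There exist infinitely many (strongly connected) digraphs $D$ with $\mathrm{diam}(D)=2$ and $\overrightarrow{trc}(D)=\overrightarrow{strc}(D)=4$.
   Context: All digraphs are finite, without loops and without multiple arcs. A digraph is strongly connected if for every ordered pair $(u,v)$ there is a directed $u$–$v$ path; $d(u,v)$ is the length (number of arcs) of a shortest $u$–$v$ path, a geodesic is a shortest path, and $\mathrm{diam}(D)=\max d(u,v)$. A total-colouring colours all vertices and arcs; a directed path is total-rainbow if its arcs and internal vertices all receive pairwise distinct colours. $\overrightarrow{trc}(D)$ (resp. $\overrightarrow{strc}(D)$) is the minimum number of colours in a total-colouring of $D$ such that for every ordered pair $(u,v)$ of vertices there is a total-rainbow $u$–$v$ path (resp. total-rainbow $u$–$v$ geodesic). -}

module Defs where

open import Data.Nat using (ℕ; zero; suc; _≤_; _<_)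
open import Data.Fin using (Fin)
open import Data.Bool using (Bool; true; false)
open import Data.List using (List; []; _∷_; _++_; map)
open import Data.List.Relation.Unary.Unique.Propositional using (Unique)
open import Data.Product using (Σ; _×_; _,_; ∃-syntax)
open import Relation.Binary.PropositionalEquality using (_≡_)
open import Relation.Nullary using (¬_)

record Digraph : Set where
  field
    order     : ℕ
    adj       : Fin order → Fin order → Bool
    loopless  : ∀ v → adj v v ≡ false

module _ (D : Digraph) where
  open Digraph D

  Vertex : Set
  Vertex = Fin order

  Arc : Vertex → Vertex → Set
  Arc u v = adj u v ≡ true

  data Walk : Vertex → Vertex → Set where
    []  : ∀ {u} → Walk u u
    _∷_ : ∀ {u w v} → Arc u w → Walk w v → Walk u v

  length : ∀ {u v} → Walk u v → ℕ
  length []      = zero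
  length (_ ∷ p) = suc (length p)

  verts : ∀ {u v} → Walk u v → List Vertex
  verts {u} []      = u ∷ []
  verts {u} (_ ∷ p) = u ∷ verts p

  inner : ∀ {u v} → Walk u v → List Vertex
  inner []                        = []
  inner (_ ∷ [])                  = []
  inner (_∷_ {w = w} _ (e ∷ p))   = w ∷ inner (e ∷ p)

  IsPath : ∀ {u v} → Walk u v → Set
  IsPath p = Unique (verts p)

  IsGeodesic : ∀ {u v} → Walk u v → Set
  IsGeodesic {u} {v} p = IsPath p × (∀ (q : Walk u v) → length p ≤ length q)

  Diam2 : Set
  Diam2 = (∀ u v → Σ (Walk u v) λ p → length p ≤ 2)
        × (∃[ u ] ∃[ v ] ∀ (p : Walk u v) → 2 ≤ length p)

  -- total-colourings with (at most) k colours
  record TotalColouring (k : ℕ) : Set where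
    field
      vcol : Vertex → Fin k
      acol : ∀ {u v} → Arc u v → Fin k

  module _ {k : ℕ} (c : TotalColouring k) where
    open TotalColouring c

    arcCols : ∀ {u v} → Walk u v → List (Fin k)
    arcCols []      = []
    arcCols (e ∷ p) = acol e ∷ arcCols p

    TotalRainbow : ∀ {u v} → Walk u v → Set
    TotalRainbow p = Unique (arcCols p ++ map vcol (inner p))

    TRConnecting : Set
    TRConnecting = ∀ u v → Σ (Walk u v) λ p → IsPath p × TotalRainbow p

    STRConnecting : Set
    STRConnecting = ∀ u v → Σ (Walk u v) λ p → IsGeodesic p × TotalRainbow p

  TRColourable : ℕ → Set
  TRColourable k = Σ (TotalColouring k) TRConnecting

  STRColourable : ℕ → Set
  STRColourable k = Σ (TotalColouring k) STRConnecting

  trc≡ : ℕ → Set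
  trc≡ k = TRColourable k × (∀ m → m < k → ¬ TRColourable m)

  strc≡ : ℕ → Set
  strc≡ k = STRColourable k × (∀ m → m < k → ¬ STRColourable m)

  StronglyConnected : Set
  StronglyConnected = ∀ u v → Walk u v

module Submission where

-- For every N we build a digraph D_N on the vertices 0,…,5 together with N
-- "copies" c₁,…,c_N (the copies form a complete digraph, each copy has arcs to
-- 1 and 2 and receives arcs from 2 and 4).
--
-- Upper bound: an explicit 4-colouring together with a table assigning to every
-- ordered pair a route (the trivial walk, an arc, or a 2-path through a named
-- midpoint); each route is checked to be a total-rainbow geodesic of length ≤ 2,
-- which also yields strong connectivity and diameter 2.
--
-- Lower bound: by recolouring along palette injections it suffices to refute 3
-- colours.  With 3 colours a total-rainbow walk between distinct non-adjacent
-- vertices is a 2-path whose two arc colours and midpoint colour are exactly the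
-- three colours.  Twelve pairs of D_N force such rainbow triples on a small set of
-- arcs and vertices, and the resulting constraints over Fin 3 are contradictory,
-- because in Fin 3 a colour avoiding two distinct colours is determined by them.

open import Defs
open import Data.Nat using (ℕ; _≤_; _<_; z≤n; s≤s; _+_)
open import Data.Nat.Properties using (m≤n+m)
open import Data.Fin using (Fin; zero; suc; inject≤; #_)
open import Data.Fin.Properties using (_≟_; punchOut-injective; inject≤-injective)
open import Data.Bool using (Bool; true; false; not; T)
open import Data.Bool.Properties using (T-≡; T-not-≡)
open import Data.List using (List; []; _∷_; _++_; map)
open import Data.List.Properties using (map-++; map-∘)
open import Data.List.Relation.Unary.All using ([]; _∷_)
open import Data.List.Relation.Unary.All.Properties using (++⁻ʳ)
open import Data.List.Relation.Unary.AllPairs using ([]; _∷_)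
open import Data.List.Relation.Unary.Unique.Propositional using (Unique)
open import Data.List.Relation.Unary.Unique.Propositional.Properties using (map⁺)
open import Data.List.Relation.Unary.Unique.DecPropositional using (unique?)
open import Data.Product using (Σ; _×_; _,_; proj₁)
open import Data.Sum using (_⊎_; inj₁; inj₂)
open import Data.Empty using (⊥; ⊥-elim)
open import Function using (_∘_)
open import Function.Bundles using (Equivalence)
open import Relation.Nullary using (¬_; yes; no; does)
open import Relation.Nullary.Decidable using (True; False; toWitness; toWitnessFalse; dec-true; dec-false)
open import Relation.Binary.PropositionalEquality
  using (_≡_; _≢_; refl; sym; trans; cong; cong₂; subst; ≢-sym; module ≡-Reasoning)

-- Arcs of a Digraph are equations adj u v ≡ true; for concrete vertices they are
-- supplied as the (automatically inferred) unit proofs T (adj u v).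
true-arc : ∀ {b} → T b → b ≡ true
true-arc = Equivalence.to T-≡

non-arc : ∀ {b} → T (not b) → b ≡ false
non-arc = Equivalence.to T-not-≡

-- The statement "a, b, c are pairwise distinct", written as the Unique list it
-- unfolds to, so that it matches both IsPath and TotalRainbow of 2-paths.
Distinct3 : ∀ {A : Set} → A → A → A → Set
Distinct3 a b c = Unique (a ∷ b ∷ c ∷ [])

pattern distinct a≢b a≢c b≢c = (a≢b ∷ a≢c ∷ []) ∷ (b≢c ∷ []) ∷ [] ∷ []

avoid-one : ∀ {c x y : Fin 2} → x ≢ c → y ≢ c → x ≡ y
avoid-one {zero}     {zero}                x≢c _   = ⊥-elim (x≢c refl)
avoid-one {zero}     {suc zero} {zero}     _   y≢c = ⊥-elim (y≢c refl)
avoid-one {zero}     {suc zero} {suc zero} _   _   = refl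
avoid-one {suc zero} {suc zero}            x≢c _   = ⊥-elim (x≢c refl)
avoid-one {suc zero} {zero}     {zero}     _   _   = refl
avoid-one {suc zero} {zero}     {suc zero} _   y≢c = ⊥-elim (y≢c refl)

-- In Fin 3 a value avoiding two distinct values a, b is determined by them:
-- punch out a and apply the Fin 2 case to the images of x, y and b.
avoid-two : ∀ {a b x y : Fin 3} → a ≢ b → x ≢ a → x ≢ b → y ≢ a → y ≢ b → x ≡ y
avoid-two a≢b x≢a x≢b y≢a y≢b =
  punchOut-injective (≢-sym x≢a) (≢-sym y≢a)
    (avoid-one (λ eq → x≢b (punchOut-injective (≢-sym x≢a) a≢b eq))
               (λ eq → y≢b (punchOut-injective (≢-sym y≢a) a≢b eq)))

-- Consequently no list over Fin 3 has four pairwise distinct entries; this is the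
-- form in which long walks appear (three arc colours, then an inner vertex colour).
no-four-distinct : ∀ {a b c d : Fin 3} (xs ys : List (Fin 3)) →
                   ¬ Unique (a ∷ b ∷ c ∷ xs ++ d ∷ ys)
no-four-distinct xs ys ((a≢b ∷ a≢c ∷ a≢rest) ∷ (b≢c ∷ b≢rest) ∷ c≢rest ∷ _)
  with a≢d ∷ _ ← ++⁻ʳ xs a≢rest | b≢d ∷ _ ← ++⁻ʳ xs b≢rest | c≢d ∷ _ ← ++⁻ʳ xs c≢rest
  = c≢d (avoid-two a≢b (≢-sym a≢c) (≢-sym b≢c) (≢-sym a≢d) (≢-sym b≢d))

module _ (D : Digraph) where
  open Digraph D

  length-≥1 : ∀ {u v} → u ≢ v → (q : Walk D u v) → 1 ≤ length D q
  length-≥1 u≢v []      = ⊥-elim (u≢v refl)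
  length-≥1 u≢v (_ ∷ _) = s≤s z≤n

  length-≥2 : ∀ {u v} → u ≢ v → adj u v ≡ false → (q : Walk D u v) → 2 ≤ length D q
  length-≥2 u≢v _   []          = ⊥-elim (u≢v refl)
  length-≥2 _   ¬uv (uv ∷ [])   with () ← trans (sym uv) ¬uv
  length-≥2 _   _   (_ ∷ _ ∷ _) = s≤s (s≤s z≤n)

  module Recolour {m k : ℕ} (f : Fin m → Fin k) (f-inj : ∀ {x y} → f x ≡ f y → x ≡ y)
                  (c : TotalColouring D m) where
    open TotalColouring c

    recoloured : TotalColouring D k
    recoloured = record { vcol = λ v → f (vcol v) ; acol = λ e → f (acol e) }

    arcCols-recoloured : ∀ {u v} (p : Walk D u v) →
                         arcCols D recoloured p ≡ map f (arcCols D c p)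
    arcCols-recoloured []      = refl
    arcCols-recoloured (e ∷ p) = cong (f (acol e) ∷_) (arcCols-recoloured p)

    colours-recoloured : ∀ {u v} (p : Walk D u v) →
      arcCols D recoloured p ++ map (λ v → f (vcol v)) (inner D p)
        ≡ map f (arcCols D c p ++ map vcol (inner D p))
    colours-recoloured p = begin
      arcCols D recoloured p ++ map (λ v → f (vcol v)) (inner D p)
        ≡⟨ cong₂ _++_ (arcCols-recoloured p) (map-∘ (inner D p)) ⟩
      map f (arcCols D c p) ++ map f (map vcol (inner D p))
        ≡⟨ sym (map-++ f (arcCols D c p) (map vcol (inner D p))) ⟩
      map f (arcCols D c p ++ map vcol (inner D p)) ∎
      where open ≡-Reasoning

    rainbow-recoloured : ∀ {u v} (p : Walk D u v) →
                         TotalRainbow D c p → TotalRainbow D recoloured p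
    rainbow-recoloured p r = subst Unique (sym (colours-recoloured p)) (map⁺ f-inj r)

  trc-monotone : ∀ {m k} → m ≤ k → TRColourable D m → TRColourable D k
  trc-monotone m≤k (c , conn) =
    recoloured , λ u v → let (p , path , r) = conn u v in p , path , rainbow-recoloured p r
    where
    open Recolour (λ i → inject≤ i m≤k) (λ {x} {y} → inject≤-injective m≤k m≤k x y) c

  strc⇒trc : ∀ {k} → STRColourable D k → TRColourable D k
  strc⇒trc (c , conn) = c , λ u v → let (p , (path , _) , r) = conn u v in p , path , r

  module ThreeColours (c : TotalColouring D 3) where
    open TotalColouring c

    Midpoint : Vertex D → Vertex D → Set
    Midpoint u v = Σ (Vertex D) λ w → Σ (Arc D u w) λ uw → Σ (Arc D w v) λ wv →
                   Distinct3 (acol uw) (acol wv) (vcol w)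

    rainbow-midpoint : ∀ {u v} → u ≢ v → adj u v ≡ false →
                       (p : Walk D u v) → TotalRainbow D c p → Midpoint u v
    rainbow-midpoint u≢v _   []              _ = ⊥-elim (u≢v refl)
    rainbow-midpoint _   ¬uv (uv ∷ [])       _ with () ← trans (sym uv) ¬uv
    rainbow-midpoint _   _   (uw ∷ wv ∷ [])  r = _ , uw , wv , r
    rainbow-midpoint _   _   (_ ∷ _ ∷ _ ∷ q) r = ⊥-elim (no-four-distinct (arcCols D c q) _ r)

  -- Certified routes: total-rainbow geodesics of length at most 2.  The smart
  -- constructors take their side conditions as decidable checks, so that for
  -- concrete vertices they are discharged by evaluation.
  module Routes {k : ℕ} (c : TotalColouring D k) where
    open TotalColouring c

    Route : Vertex D → Vertex D → Set
    Route u v = Σ (Walk D u v) λ p → IsGeodesic D p × TotalRainbow D c p × length D p ≤ 2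

    stay : ∀ {u} → Route u u
    stay = [] , ([] ∷ [] , λ _ → z≤n) , [] , z≤n

    arc′ : ∀ {u v} → u ≢ v → Arc D u v → Route u v
    arc′ u≢v uv = uv ∷ [] , ((u≢v ∷ []) ∷ [] ∷ [] , length-≥1 u≢v) , [] ∷ [] , s≤s z≤n

    arc : ∀ {u v} {uv : T (adj u v)} {u≢v : False (u ≟ v)} → Route u v
    arc {uv = uv} {u≢v} = arc′ (toWitnessFalse u≢v) (true-arc uv)

    via : ∀ {u v} w {uw : T (adj u w)} {wv : T (adj w v)} {¬uv : T (not (adj u v))}
          {path : True (unique? _≟_ (u ∷ w ∷ v ∷ []))}
          {rainbow : True (unique? _≟_ (acol (true-arc uw) ∷
                                        acol (true-arc wv) ∷ vcol w ∷ []))} →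
          Route u v
    via w {uw} {wv} {¬uv} {path} {rainbow} with distinct _ u≢v _ ← toWitness path =
      true-arc uw ∷ true-arc wv ∷ [] ,
      (toWitness path , length-≥2 u≢v (non-arc ¬uv)) ,
      toWitness rainbow , s≤s (s≤s z≤n)

pattern n₀ = zero
pattern n₁ = suc n₀
pattern n₂ = suc n₁
pattern n₃ = suc n₂
pattern n₄ = suc n₃
pattern n₅ = suc n₄
pattern copy i = suc (suc (suc (suc (suc (suc i)))))

adjacent : ∀ {N} → Fin (6 + N) → Fin (6 + N) → Bool
adjacent n₀ n₂ = true
adjacent n₀ n₃ = true
adjacent n₁ n₀ = true
adjacent n₁ n₄ = true
adjacent n₁ n₅ = true
adjacent n₂ n₃ = true
adjacent n₂ n₅ = true
adjacent n₂ (copy _) = true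
adjacent n₃ n₁ = true
adjacent n₃ n₄ = true
adjacent n₄ n₁ = true
adjacent n₄ n₂ = true
adjacent n₄ (copy _) = true
adjacent n₅ n₀ = true
adjacent n₅ n₄ = true
adjacent (copy _) n₁ = true
adjacent (copy _) n₂ = true
adjacent (copy i) (copy j) = not (does (i ≟ j))
adjacent _ _ = false

adjacent-loopless : ∀ {N} (v : Fin (6 + N)) → adjacent v v ≡ false
adjacent-loopless n₀ = refl
adjacent-loopless n₁ = refl
adjacent-loopless n₂ = refl
adjacent-loopless n₃ = refl
adjacent-loopless n₄ = refl
adjacent-loopless n₅ = refl
adjacent-loopless (copy i) = cong not (dec-true (i ≟ i) refl)

D[_] : ℕ → Digraph
D[ N ] = record { order = 6 + N ; adj = adjacent ; loopless = adjacent-loopless }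

-- Arc colours (the value at a non-arc is irrelevant); unlisted arcs get colour 0.
arcColour : ∀ {N} → Fin (6 + N) → Fin (6 + N) → Fin 4
arcColour n₁ n₀ = # 1
arcColour n₁ n₄ = # 1
arcColour n₁ n₅ = # 1
arcColour n₂ n₅ = # 1
arcColour n₂ (copy _) = # 1
arcColour n₃ n₁ = # 2
arcColour n₃ n₄ = # 2
arcColour n₄ n₁ = # 2
arcColour n₄ n₂ = # 1
arcColour n₄ (copy _) = # 3
arcColour n₅ n₀ = # 3
arcColour n₅ n₄ = # 1
arcColour (copy _) n₁ = # 2
arcColour (copy _) n₂ = # 1
arcColour _ _ = # 0

vertexColour : ∀ {N} → Fin (6 + N) → Fin 4
vertexColour n₀ = # 2
vertexColour n₂ = # 2
vertexColour n₃ = # 1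
vertexColour _  = # 0

colouring : ∀ N → TotalColouring D[ N ] 4
colouring N = record { vcol = vertexColour ; acol = λ {u} {v} _ → arcColour u v }

route : ∀ N (u v : Fin (6 + N)) → Routes.Route D[ N ] (colouring N) u v
route N = table
  where
  open Routes D[ N ] (colouring N)
  table : ∀ u v → Route u v
  table n₀ n₀ = stay
  table n₀ n₁ = via n₃
  table n₀ n₂ = arc
  table n₀ n₃ = arc
  table n₀ n₄ = via n₃
  table n₀ n₅ = via n₂
  table n₀ (copy _) = via n₂
  table n₁ n₀ = arc
  table n₁ n₁ = stay
  table n₁ n₂ = via n₀
  table n₁ n₃ = via n₀
  table n₁ n₄ = arc
  table n₁ n₅ = arc
  table n₁ (copy _) = via n₄
  table n₂ n₀ = via n₅
  table n₂ n₁ = via n₃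
  table n₂ n₂ = stay
  table n₂ n₃ = arc
  table n₂ n₄ = via n₃
  table n₂ n₅ = arc
  table n₂ (copy _) = arc
  table n₃ n₀ = via n₁
  table n₃ n₁ = arc
  table n₃ n₂ = via n₄
  table n₃ n₃ = stay
  table n₃ n₄ = arc
  table n₃ n₅ = via n₁
  table n₃ (copy _) = via n₄
  table n₄ n₀ = via n₁
  table n₄ n₁ = arc
  table n₄ n₂ = arc
  table n₄ n₃ = via n₂
  table n₄ n₄ = stay
  table n₄ n₅ = via n₁
  table n₄ (copy _) = arc
  table n₅ n₀ = arc
  table n₅ n₁ = via n₄
  table n₅ n₂ = via n₀
  table n₅ n₃ = via n₀
  table n₅ n₄ = arc
  table n₅ n₅ = stay
  table n₅ (copy _) = via n₄
  table (copy _) n₀ = via n₁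
  table (copy _) n₁ = arc
  table (copy _) n₂ = arc
  table (copy _) n₃ = via n₂
  table (copy _) n₄ = via n₁
  table (copy _) n₅ = via n₁
  table (copy i) (copy j) with i ≟ j
  ... | yes refl = stay
  ... | no i≢j   = arc′ (λ { refl → i≢j refl }) (cong not (dec-false (i ≟ j) i≢j))

-- The constraints forced by twelve non-adjacent pairs of D_N (below), with aᵤᵥ
-- the colour of the arc u → v and vᵤ that of vertex u, have no solution in
-- Fin 3.  First the arcs 3 → 1, 3 → 4 and 4 → 1 are forced to share a colour,
-- then so are 5 → 4 and 4 → 2; this rules out the route 5 → 4 → 2, and both
-- possible routes from 2 to 4 then lead to a contradiction.
obstruction :
  ∀ {a02 a03 a10 a23 a25 a31 a34 a41 a42 a50 a54 v0 v1 v2 v3 v4 v5 : Fin 3} →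
  Distinct3 a03 a31 v3 → Distinct3 a03 a34 v3 → Distinct3 a34 a42 v4 →
  Distinct3 a10 a03 v0 → Distinct3 a31 a10 v1 → Distinct3 a41 a10 v1 →
  Distinct3 a54 a41 v4 → Distinct3 a42 a23 v2 → Distinct3 a02 a25 v2 →
  Distinct3 a25 a50 v5 →
  Distinct3 a50 a02 v0 ⊎ Distinct3 a54 a42 v4 →
  Distinct3 a23 a34 v3 ⊎ Distinct3 a25 a54 v5 → ⊥
obstruction {a02} {a03} {a10} {a23} {a25} {a31} {a34} {a41} {a42} {a50} {a54} {v0} {v1} {v2} {v3} {v4} {v5}
  (distinct a03≢a31 _ a31≢v3) (distinct a03≢a34 a03≢v3 a34≢v3) (distinct a34≢a42 a34≢v4 a42≢v4)
  (distinct a10≢a03 a10≢v0 a03≢v0) (distinct a31≢a10 a31≢v1 a10≢v1) (distinct a41≢a10 a41≢v1 _)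
  (distinct a54≢a41 a54≢v4 _) (distinct a42≢a23 a42≢v2 a23≢v2) (distinct a02≢a25 a02≢v2 a25≢v2)
  (distinct a25≢a50 a25≢v5 a50≢v5) = routes
  where
  -- 3 → 1 and 3 → 4 both avoid {a03, v3}; 4 → 1 and 3 → 1 both avoid {a10, v1}.
  a31≡a34 : a31 ≡ a34
  a31≡a34 = avoid-two a03≢v3 (≢-sym a03≢a31) a31≢v3 (≢-sym a03≢a34) a34≢v3

  a41≡a34 : a41 ≡ a34
  a41≡a34 = trans (avoid-two a10≢v1 a41≢a10 a41≢v1 a31≢a10 a31≢v1) a31≡a34

  -- 5 → 4 and 4 → 2 both avoid {a34, v4}.
  a54≡a42 : a54 ≡ a42
  a54≡a42 = avoid-two a34≢v4 (subst (a54 ≢_) a41≡a34 a54≢a41) a54≢v4 (≢-sym a34≢a42) a42≢v4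

  routes : Distinct3 a50 a02 v0 ⊎ Distinct3 a54 a42 v4 →
           Distinct3 a23 a34 v3 ⊎ Distinct3 a25 a54 v5 → ⊥
  routes (inj₂ (distinct a54≢a42 _ _)) _ = a54≢a42 a54≡a42
  -- Route 2 → 3 → 4: then v2 and v0 both equal a34, which forces a25 ≡ a50.
  routes (inj₁ (distinct a50≢a02 a50≢v0 _)) (inj₁ (distinct a23≢a34 _ _)) = a25≢a50 a25≡a50
    where
    v2≡a34 : v2 ≡ a34
    v2≡a34 = avoid-two a42≢a23 (≢-sym a42≢v2) (≢-sym a23≢v2) a34≢a42 (≢-sym a23≢a34)

    v0≡a34 : v0 ≡ a34
    v0≡a34 = avoid-two a10≢a03 (≢-sym a10≢v0) (≢-sym a03≢v0)
                       (subst (_≢ a10) a31≡a34 a31≢a10) (≢-sym a03≢a34)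

    a25≡a50 : a25 ≡ a50
    a25≡a50 = avoid-two a02≢v2 (≢-sym a02≢a25) a25≢v2 a50≢a02
                        (subst (a50 ≢_) (trans v0≡a34 (sym v2≡a34)) a50≢v0)
  -- Route 2 → 5 → 4: then a42 avoids {a02, a25}, as does v2, so a42 ≡ v2.
  routes (inj₁ (distinct a50≢a02 _ _)) (inj₂ (distinct a25≢a54 _ a54≢v5)) = a42≢v2 a42≡v2
    where
    a54≡a50 : a54 ≡ a50
    a54≡a50 = avoid-two a25≢v5 (≢-sym a25≢a54) a54≢v5 (≢-sym a25≢a50) a50≢v5

    a42≡v2 : a42 ≡ v2
    a42≡v2 = avoid-two a02≢a25 (subst (_≢ a02) (trans (sym a54≡a50) a54≡a42) a50≢a02)
                       (subst (_≢ a25) a54≡a42 (≢-sym a25≢a54)) (≢-sym a02≢v2) (≢-sym a25≢v2)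

module Forced (N : ℕ) (c : TotalColouring D[ N ] 3) where
  open TotalColouring c
  open ThreeColours D[ N ] c

  χ : (u v : Fin (6 + N)) {uv : T (adjacent u v)} → Fin 3
  χ u v {uv} = acol {u} {v} (true-arc uv)

  forced-01 : Midpoint n₀ n₁ →
    Distinct3 (χ n₀ n₃) (χ n₃ n₁) (vcol n₃)
  forced-01 (n₀ , () , _)
  forced-01 (n₁ , () , _)
  forced-01 (n₂ , _ , () , _)
  forced-01 (n₃ , refl , refl , r) = r
  forced-01 (n₄ , () , _)
  forced-01 (n₅ , () , _)
  forced-01 (copy _ , () , _)

  forced-04 : Midpoint n₀ n₄ →
    Distinct3 (χ n₀ n₃) (χ n₃ n₄) (vcol n₃)
  forced-04 (n₀ , () , _)
  forced-04 (n₁ , () , _)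
  forced-04 (n₂ , _ , () , _)
  forced-04 (n₃ , refl , refl , r) = r
  forced-04 (n₄ , () , _)
  forced-04 (n₅ , () , _)
  forced-04 (copy _ , () , _)

  forced-05 : Midpoint n₀ n₅ →
    Distinct3 (χ n₀ n₂) (χ n₂ n₅) (vcol n₂)
  forced-05 (n₀ , () , _)
  forced-05 (n₁ , () , _)
  forced-05 (n₂ , refl , refl , r) = r
  forced-05 (n₃ , _ , () , _)
  forced-05 (n₄ , () , _)
  forced-05 (n₅ , () , _)
  forced-05 (copy _ , () , _)

  forced-13 : Midpoint n₁ n₃ →
    Distinct3 (χ n₁ n₀) (χ n₀ n₃) (vcol n₀)
  forced-13 (n₀ , refl , refl , r) = r
  forced-13 (n₁ , () , _)
  forced-13 (n₂ , () , _)
  forced-13 (n₃ , () , _)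
  forced-13 (n₄ , _ , () , _)
  forced-13 (n₅ , _ , () , _)
  forced-13 (copy _ , () , _)

  forced-20 : Midpoint n₂ n₀ →
    Distinct3 (χ n₂ n₅) (χ n₅ n₀) (vcol n₅)
  forced-20 (n₀ , () , _)
  forced-20 (n₁ , () , _)
  forced-20 (n₂ , () , _)
  forced-20 (n₃ , _ , () , _)
  forced-20 (n₄ , () , _)
  forced-20 (n₅ , refl , refl , r) = r
  forced-20 (copy _ , _ , () , _)

  forced-24 : Midpoint n₂ n₄ →
    Distinct3 (χ n₂ n₃) (χ n₃ n₄) (vcol n₃)
      ⊎ Distinct3 (χ n₂ n₅) (χ n₅ n₄) (vcol n₅)
  forced-24 (n₀ , () , _)
  forced-24 (n₁ , () , _)
  forced-24 (n₂ , () , _)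
  forced-24 (n₃ , refl , refl , r) = inj₁ r
  forced-24 (n₄ , () , _)
  forced-24 (n₅ , refl , refl , r) = inj₂ r
  forced-24 (copy _ , _ , () , _)

  forced-30 : Midpoint n₃ n₀ →
    Distinct3 (χ n₃ n₁) (χ n₁ n₀) (vcol n₁)
  forced-30 (n₀ , () , _)
  forced-30 (n₁ , refl , refl , r) = r
  forced-30 (n₂ , () , _)
  forced-30 (n₃ , () , _)
  forced-30 (n₄ , _ , () , _)
  forced-30 (n₅ , () , _)
  forced-30 (copy _ , () , _)

  forced-32 : Midpoint n₃ n₂ →
    Distinct3 (χ n₃ n₄) (χ n₄ n₂) (vcol n₄)
  forced-32 (n₀ , () , _)
  forced-32 (n₁ , _ , () , _)
  forced-32 (n₂ , () , _)
  forced-32 (n₃ , () , _)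
  forced-32 (n₄ , refl , refl , r) = r
  forced-32 (n₅ , () , _)
  forced-32 (copy _ , () , _)

  forced-40 : Midpoint n₄ n₀ →
    Distinct3 (χ n₄ n₁) (χ n₁ n₀) (vcol n₁)
  forced-40 (n₀ , () , _)
  forced-40 (n₁ , refl , refl , r) = r
  forced-40 (n₂ , _ , () , _)
  forced-40 (n₃ , () , _)
  forced-40 (n₄ , () , _)
  forced-40 (n₅ , () , _)
  forced-40 (copy _ , _ , () , _)

  forced-43 : Midpoint n₄ n₃ →
    Distinct3 (χ n₄ n₂) (χ n₂ n₃) (vcol n₂)
  forced-43 (n₀ , () , _)
  forced-43 (n₁ , _ , () , _)
  forced-43 (n₂ , refl , refl , r) = r
  forced-43 (n₃ , () , _)
  forced-43 (n₄ , () , _)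
  forced-43 (n₅ , () , _)
  forced-43 (copy _ , _ , () , _)

  forced-51 : Midpoint n₅ n₁ →
    Distinct3 (χ n₅ n₄) (χ n₄ n₁) (vcol n₄)
  forced-51 (n₀ , _ , () , _)
  forced-51 (n₁ , () , _)
  forced-51 (n₂ , () , _)
  forced-51 (n₃ , () , _)
  forced-51 (n₄ , refl , refl , r) = r
  forced-51 (n₅ , () , _)
  forced-51 (copy _ , () , _)

  forced-52 : Midpoint n₅ n₂ →
    Distinct3 (χ n₅ n₀) (χ n₀ n₂) (vcol n₀)
      ⊎ Distinct3 (χ n₅ n₄) (χ n₄ n₂) (vcol n₄)
  forced-52 (n₀ , refl , refl , r) = inj₁ r
  forced-52 (n₁ , () , _)
  forced-52 (n₂ , () , _)
  forced-52 (n₃ , () , _)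
  forced-52 (n₄ , refl , refl , r) = inj₂ r
  forced-52 (n₅ , () , _)
  forced-52 (copy _ , () , _)

no-three-colouring : ∀ N (c : TotalColouring D[ N ] 3) → ¬ TRConnecting D[ N ] c
no-three-colouring N c conn =
  obstruction (forced-01 (midpoint n₀ n₁)) (forced-04 (midpoint n₀ n₄)) (forced-32 (midpoint n₃ n₂))
              (forced-13 (midpoint n₁ n₃)) (forced-30 (midpoint n₃ n₀)) (forced-40 (midpoint n₄ n₀))
              (forced-51 (midpoint n₅ n₁)) (forced-43 (midpoint n₄ n₃)) (forced-05 (midpoint n₀ n₅))
              (forced-20 (midpoint n₂ n₀)) (forced-52 (midpoint n₅ n₂)) (forced-24 (midpoint n₂ n₄))
  where
  open Forced N c
  open ThreeColours D[ N ] c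

  midpoint : ∀ u v {¬uv : T (not (adjacent u v))} {u≢v : False (u ≟ v)} → Midpoint u v
  midpoint u v {¬uv} {u≢v} =
    let (p , _ , r) = conn u v
    in rainbow-midpoint (toWitnessFalse u≢v) (non-arc ¬uv) p r

no-trc-below-4 : ∀ N m → m < 4 → ¬ TRColourable D[ N ] m
no-trc-below-4 N m (s≤s m≤3) col
  with c , conn ← trc-monotone D[ N ] m≤3 col = no-three-colouring N c conn

strc-4 : ∀ N → STRColourable D[ N ] 4
strc-4 N = colouring N , λ u v → let (p , geodesic , rainbow , _) = route N u v in p , geodesic , rainbow

lemma3 : ∀ (N : ℕ) → Σ Digraph λ D → N ≤ Digraph.order D
             × StronglyConnected D × Diam2 D × trc≡ D 4 × strc≡ D 4
lemma3 N =
  D[ N ] , m≤n+m N 6 , strongly-connected , diameter-2 ,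
  (strc⇒trc D[ N ] (strc-4 N) , no-trc-below-4 N) ,
  (strc-4 N , λ m m<4 → no-trc-below-4 N m m<4 ∘ strc⇒trc D[ N ])
  where
  strongly-connected : StronglyConnected D[ N ]
  strongly-connected u v = proj₁ (route N u v)

  diameter-2 : Diam2 D[ N ]
  diameter-2 = (λ u v → let (p , _ , _ , short) = route N u v in p , short)
             , n₀ , n₁ , length-≥2 D[ N ] (λ ()) refl
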